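{- Let $Q$ be a unital quantale and $M$ a left $Q$-module with top element $\top$ (of $M$) and let $\top$ also denote the top of $Q$. Then: (i) for every $Q$-ideal $I$ of $M$, $I = [\bot,\bigvee I]$; (ii) for every subset $S\subseteq M$, the ideal generated by $S$ is $(S] = [\bot, \top\ast\bigvee S]$; in particular $(v] = [\bot,\top\ast v]$ for all $v\in M$; (iii) the $Q$-ideals of $M$ are precisely the intervals $[\bot,v]$ with $v\in M$ such that $\top\ast v = v$; (iv) every $Q$-ideal of $M$ is principal (generated by a single element); (v) if $[\bot,v]$ is a $Q$-ideal of $M$, then $\{w\in M \mid v\le w\le \top\}$ is a $Q$-ideal of the right $Q$-module $M^{\operatorname{op}}$.
   Context: A unital quantale is a complete lattice $Q$ with an associative multiplication with unit $1$ distributing over arbitrary joins in both arguments. A left $Q$-module is a complete lattice $M$ with scalar multiplication $\ast:Q\times M\to M$ satisfying $(ab)\ast v=a\ast(b\ast v)$, $1\ast v=v$, and distributivity over arbitrary joins in both arguments. $[\bot,v]=\{w\in M\mid w\le v\}$. A $Q$-ideal of a (left) $Q$-module $M$ is a subset $I$ such that (a) $Y\subseteq I$ implies $\bigvee Y\in I$; (b) $v\in I$ and $w\le v$ imply $w\in I$; (c) $v\in I$ implies $a\ast v\in I$ for all $a\in Q$ (for right modules, with the right scalar multiplication). $(S]$ denotes the smallest $Q$-ideal containing $S$. For $a\in Q$, $v\in M$, let $a\backslash_\ast v = \bigvee\{w\in M\mid a\ast w\le v\}$. $M^{\operatorname{op}}$ is the complete lattice $M$ with the reversed order (joins are meets of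 $M$), made into a right $Q$-module with scalar multiplication $(v,a)\mapsto a\backslash_\ast v$. -}

module Defs where

open import Level using (Level; suc; Lift; lift)
open import Data.Unit using (⊤)
open import Data.Empty using (⊥)
open import Data.Product using (Σ; _×_; _,_; ∃)
open import Relation.Unary using (Pred; _⊆_; _≐_)
open import Relation.Binary.PropositionalEquality using (_≡_)
open import Relation.Binary.Structures using (IsPartialOrder)

record CompleteLattice (ℓ : Level) : Set (suc ℓ) where
  infix 4 _≤_
  field
    Carrier        : Set ℓ
    _≤_            : Carrier → Carrier → Set ℓ
    isPartialOrder : IsPartialOrder _≡_ _≤_
    ⋁              : Pred Carrier ℓ → Carrier
    ⋁-upper        : ∀ (S : Pred Carrier ℓ) x → S x → x ≤ ⋁ S
    ⋁-least        : ∀ (S : Pred Carrier ℓ) y → (∀ x → S x → x ≤ y) → ⋁ S ≤ y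

  bot : Carrier
  bot = ⋁ (λ _ → Lift ℓ ⊥)

  top : Carrier
  top = ⋁ (λ _ → Lift ℓ ⊤)

  ⋀ : Pred Carrier ℓ → Carrier
  ⋀ Y = ⋁ (λ w → ∀ y → Y y → w ≤ y)

  downset : Carrier → Pred Carrier ℓ
  downset v = λ w → w ≤ v

image : ∀ {ℓ} {A B : Set ℓ} → (A → B) → Pred A ℓ → Pred B ℓ
image f S = λ z → Σ _ (λ x → S x × (z ≡ f x))

record UnitalQuantale (ℓ : Level) : Set (suc ℓ) where
  field
    lattice : CompleteLattice ℓ
  open CompleteLattice lattice public
  infixl 7 _·_
  field
    _·_     : Carrier → Carrier → Carrier
    one     : Carrier
    ·-assoc : ∀ a b c → (a · b) · c ≡ a · (b · c)
    ·-identityˡ : ∀ a → one · a ≡ a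
    ·-identityʳ : ∀ a → a · one ≡ a
    ·-distribˡ-⋁ : ∀ a (S : Pred Carrier ℓ) → a · ⋁ S ≡ ⋁ (image (a ·_) S)
    ·-distribʳ-⋁ : ∀ (S : Pred Carrier ℓ) a → ⋁ S · a ≡ ⋁ (image (_· a) S)

record LeftModule {ℓ : Level} (Q : UnitalQuantale ℓ) : Set (suc ℓ) where
  private module Q = UnitalQuantale Q
  field
    lattice : CompleteLattice ℓ
  open CompleteLattice lattice public
  infixr 7 _∗_
  field
    _∗_      : Q.Carrier → Carrier → Carrier
    ∗-assoc  : ∀ a b v → (a Q.· b) ∗ v ≡ a ∗ (b ∗ v)
    ∗-identity : ∀ v → Q.one ∗ v ≡ v
    ∗-distribˡ-⋁ : ∀ a (T : Pred Carrier ℓ) → a ∗ ⋁ T ≡ ⋁ (image (a ∗_) T)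
    ∗-distribʳ-⋁ : ∀ (S : Pred Q.Carrier ℓ) v → Q.⋁ S ∗ v ≡ ⋁ (image (_∗ v) S)

  _\∗_ : Q.Carrier → Carrier → Carrier
  a \∗ v = ⋁ (λ w → a ∗ w ≤ v)

-- Q-ideal of a (left or right) Q-module, given by its order, its join
-- operation and its scalar action (written as a map Q → M → M; for a right
-- module, act a v stands for v·a).
record IsIdealFor {ℓ : Level} {QC M : Set ℓ}
    (_≤_ : M → M → Set ℓ) (join : Pred M ℓ → M) (act : QC → M → M)
    (I : Pred M ℓ) : Set (suc ℓ) where
  field
    join-closed : ∀ (Y : Pred M ℓ) → Y ⊆ I → I (join Y)
    down-closed : ∀ v w → I v → w ≤ v → I w
    act-closed  : ∀ a v → I v → I (act a v)

module _ {ℓ : Level} {Q : UnitalQuantale ℓ} (M : LeftModule Q) where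
  open LeftModule M

  IsIdeal : Pred Carrier ℓ → Set (suc ℓ)
  IsIdeal = IsIdealFor _≤_ ⋁ _∗_

  -- Q-ideal of the right Q-module M^op: order reversed, joins are meets of M,
  -- right action (v , a) ↦ a \∗ v.
  IsOpIdeal : Pred Carrier ℓ → Set (suc ℓ)
  IsOpIdeal = IsIdealFor (λ x y → y ≤ x) ⋀ _\∗_

  IsGeneratedBy : Pred Carrier ℓ → Pred Carrier ℓ → Set (suc ℓ)
  IsGeneratedBy S I =
    IsIdeal I × S ⊆ I × (∀ (J : Pred Carrier ℓ) → IsIdeal J → S ⊆ J → I ⊆ J)

  singleton : Carrier → Pred Carrier ℓ
  singleton v = λ w → w ≡ v

module Submission where

-- The whole proposition rests on two observations.
--   * A Q-ideal I contains its own join (closure under joins), so by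
--     down-closure I = [⊥, ⋁ I]; closure under ⊤ ∗ _ then forces ⊤ ∗ ⋁ I = ⋁ I.
--   * Conversely [⊥, v] is a Q-ideal as soon as v absorbs every scalar
--     (a ∗ v ≤ v for all a).  Since a ∗ x ≤ ⊤ ∗ x, every element ⊤ ∗ u
--     absorbs scalars; and any ideal containing S contains ⊤ ∗ ⋁ S, so
--     [⊥, ⊤ ∗ ⋁ S] = (S].
-- The file first proves the order-theoretic facts about the action
-- (monotonicity, a ∗ x ≤ ⊤ ∗ x, x ≤ ⊤ ∗ x), then the two observations, then
-- the facts that ideals and generated ideals are invariant under extensional
-- equality of predicates.  Parts (i)–(v) follow in a few lines each; (v) only
-- uses that v absorbs scalars, through the adjunction a ∗ w ≤ v ⇒ w ≤ a \∗ v.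

open import Defs
open import Level using (Level; Lift; lift)
open import Data.Unit using (⊤; tt)
open import Data.Product using (_×_; ∃; _,_; proj₁)
open import Relation.Unary using (Pred; _≐_)
open import Relation.Unary.Properties using (≐-sym)
open import Relation.Binary.PropositionalEquality using (_≡_; refl; cong; subst)
open import Relation.Binary.Bundles using (Poset)
open import Relation.Binary.Structures using (IsPartialOrder)
open import Function.Bundles using (_⇔_; mk⇔)

-- Being an ideal only depends on the predicate up to extensional equality;
-- stated for arbitrary order/join/action, so it serves left and right modules.
isIdealFor-resp-≐ : ∀ {ℓ} {QC M : Set ℓ} {_≤_ : M → M → Set ℓ}
  {join : Pred M ℓ → M} {act : QC → M → M} {I J : Pred M ℓ} →
  I ≐ J → IsIdealFor _≤_ join act I → IsIdealFor _≤_ join act J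
isIdealFor-resp-≐ (I⊆J , J⊆I) isI = record
  { join-closed = λ Y Y⊆J → I⊆J (join-closed Y (λ y → J⊆I (Y⊆J y)))
  ; down-closed = λ v w Jv w≤v → I⊆J (down-closed v w (J⊆I Jv) w≤v)
  ; act-closed  = λ a v Jv → I⊆J (act-closed a v (J⊆I Jv))
  }
  where open IsIdealFor isI

module Ideals {ℓ : Level} {Q : UnitalQuantale ℓ} (M : LeftModule Q) where
  open LeftModule M
  private module Q = UnitalQuantale Q
  open IsPartialOrder isPartialOrder using (antisym; reflexive)
    renaming (refl to ≤-refl; trans to ≤-trans)
  open IsIdealFor

  poset : Poset ℓ ℓ ℓ
  poset = record { isPartialOrder = isPartialOrder }

  open import Relation.Binary.Reasoning.PartialOrder poset

  ⋁-downset : ∀ v → ⋁ (downset v) ≡ v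
  ⋁-downset v = antisym (⋁-least _ v (λ _ w≤v → w≤v)) (⋁-upper _ v ≤-refl)

  ⋁-singleton : ∀ v → ⋁ (singleton M v) ≡ v
  ⋁-singleton v = antisym (⋁-least _ v (λ _ w≡v → reflexive w≡v))
                          (⋁-upper _ v refl)

  ∗-monoʳ : ∀ a {w v} → w ≤ v → a ∗ w ≤ a ∗ v
  ∗-monoʳ a {w} {v} w≤v = begin
    a ∗ w                       ≤⟨ ⋁-upper _ (a ∗ w) (w , w≤v , refl) ⟩
    ⋁ (image (a ∗_) (downset v)) ≡⟨ ∗-distribˡ-⋁ a (downset v) ⟨
    a ∗ ⋁ (downset v)           ≡⟨ cong (a ∗_) (⋁-downset v) ⟩
    a ∗ v                       ∎

  ∗-≤-top∗ : ∀ a x → a ∗ x ≤ Q.top ∗ x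
  ∗-≤-top∗ a x = begin
    a ∗ x                           ≤⟨ ⋁-upper _ (a ∗ x) (a , lift tt , refl) ⟩
    ⋁ (image (_∗ x) (λ _ → Lift ℓ ⊤)) ≡⟨ ∗-distribʳ-⋁ _ x ⟨
    Q.top ∗ x                       ∎

  ≤-top∗ : ∀ x → x ≤ Q.top ∗ x
  ≤-top∗ x = begin
    x           ≡⟨ ∗-identity x ⟨
    Q.one ∗ x   ≤⟨ ∗-≤-top∗ Q.one x ⟩
    Q.top ∗ x   ∎

  Absorbing : Carrier → Set ℓ
  Absorbing v = ∀ a → a ∗ v ≤ v

  top∗-absorbing : ∀ u → Absorbing (Q.top ∗ u)
  top∗-absorbing u a = begin
    a ∗ (Q.top ∗ u)   ≡⟨ ∗-assoc a Q.top u ⟨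
    (a Q.· Q.top) ∗ u ≤⟨ ∗-≤-top∗ (a Q.· Q.top) u ⟩
    Q.top ∗ u         ∎

  absorbing⇒top∗-fixed : ∀ {v} → Absorbing v → Q.top ∗ v ≡ v
  absorbing⇒top∗-fixed {v} abs = antisym (abs Q.top) (≤-top∗ v)

  downset-isIdeal : ∀ {v} → Absorbing v → IsIdeal M (downset v)
  downset-isIdeal {v} abs = record
    { join-closed = λ Y Y≤v → ⋁-least Y v (λ _ y∈Y → Y≤v y∈Y)
    ; down-closed = λ _ _ w≤v x≤w → ≤-trans x≤w w≤v
    ; act-closed  = λ a w w≤v → ≤-trans (∗-monoʳ a w≤v) (abs a)
    }

  downset-ideal⇒absorbing : ∀ {v} → IsIdeal M (downset v) → Absorbing v
  downset-ideal⇒absorbing {v} isI a = act-closed isI a v ≤-refl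

  ideal-∋-⋁ : ∀ {I} → IsIdeal M I → I (⋁ I)
  ideal-∋-⋁ {I} isI = join-closed isI I (λ x∈I → x∈I)

  ideal≐downset : ∀ {I} → IsIdeal M I → I ≐ downset (⋁ I)
  ideal≐downset {I} isI = (λ {x} x∈I → ⋁-upper I x x∈I)
                        , (λ {x} x≤⋁I → down-closed isI _ x (ideal-∋-⋁ isI) x≤⋁I)

  ideal-⋁-absorbing : ∀ {I} → IsIdeal M I → Absorbing (⋁ I)
  ideal-⋁-absorbing {I} isI a = ⋁-upper I _ (act-closed isI a _ (ideal-∋-⋁ isI))

  -- (S] = [⊥, ⊤ ∗ ⋁ S]: any ideal containing S contains ⋁ S, hence ⊤ ∗ ⋁ S.
  downset-top∗⋁-generated : ∀ S → IsGeneratedBy M S (downset (Q.top ∗ ⋁ S))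
  downset-top∗⋁-generated S =
      downset-isIdeal (top∗-absorbing (⋁ S))
    , (λ {x} x∈S → ≤-trans (⋁-upper S x x∈S) (≤-top∗ (⋁ S)))
    , (λ J isJ S⊆J {x} x≤top∗⋁S → down-closed isJ _ x
         (act-closed isJ Q.top _ (join-closed isJ S S⊆J)) x≤top∗⋁S)

  generated-resp-≐ : ∀ {S I J} → I ≐ J → IsGeneratedBy M S I → IsGeneratedBy M S J
  generated-resp-≐ (I⊆J , J⊆I) (isI , S⊆I , I-least) =
      isIdealFor-resp-≐ (I⊆J , J⊆I) isI
    , (λ x∈S → I⊆J (S⊆I x∈S))
    , (λ K isK S⊆K x∈J → I-least K isK S⊆K (J⊆I x∈J))

  principal : ∀ v → IsGeneratedBy M (singleton M v) (downset (Q.top ∗ v))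
  principal v = subst (λ u → IsGeneratedBy M (singleton M v) (downset (Q.top ∗ u)))
                      (⋁-singleton v) (downset-top∗⋁-generated (singleton M v))

  ideal⇒fixed-downset : ∀ {I} → IsIdeal M I → ∃ (λ v → (Q.top ∗ v ≡ v) × (I ≐ downset v))
  ideal⇒fixed-downset isI =
    _ , absorbing⇒top∗-fixed (ideal-⋁-absorbing isI) , ideal≐downset isI

  fixed-downset⇒ideal : ∀ {I} → ∃ (λ v → (Q.top ∗ v ≡ v) × (I ≐ downset v)) → IsIdeal M I
  fixed-downset⇒ideal (v , top∗v≡v , I≐↓v) =
    isIdealFor-resp-≐ (≐-sym I≐↓v)
      (downset-isIdeal (subst Absorbing top∗v≡v (top∗-absorbing v)))

  -- Every ideal is principal: I = [⊥, ⋁ I] = [⊥, ⊤ ∗ ⋁ I] = (⋁ I].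
  generated-by-join : ∀ {I} → IsIdeal M I → IsGeneratedBy M (singleton M (⋁ I)) I
  generated-by-join {I} isI =
    generated-resp-≐ (≐-sym (ideal≐downset isI))
      (subst (λ u → IsGeneratedBy M (singleton M (⋁ I)) (downset u))
             (absorbing⇒top∗-fixed (ideal-⋁-absorbing isI))
             (principal (⋁ I)))

  -- In M^op, the up-set of an absorbing v (capped by ⊤) is a right ideal:
  -- a ∗ v ≤ v ≤ w gives v ≤ a \∗ w by the residuation adjunction.
  upset-isOpIdeal : ∀ {v} → Absorbing v → IsOpIdeal M (λ w → (v ≤ w) × (w ≤ top))
  upset-isOpIdeal {v} abs = record
    { join-closed = λ Y Y⊆ → ⋁-upper _ v (λ _ y∈Y → proj₁ (Y⊆ y∈Y)) , ≤-top
    ; down-closed = λ _ _ (v≤x , _) x≤w → ≤-trans v≤x x≤w , ≤-top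
    ; act-closed  = λ a _ (v≤w , _) → ⋁-upper _ v (≤-trans (abs a) v≤w) , ≤-top
    }
    where
    ≤-top : ∀ {x} → x ≤ top
    ≤-top {x} = ⋁-upper _ x (lift tt)

proposition3p2 : ∀ {ℓ : Level} (Q : UnitalQuantale ℓ) (M : LeftModule Q) →
    let open LeftModule M
        module Q = UnitalQuantale Q
    in
    (∀ (I : Pred Carrier ℓ) → IsIdeal M I → I ≐ downset (⋁ I))
    × (∀ (S : Pred Carrier ℓ) → IsGeneratedBy M S (downset (Q.top ∗ ⋁ S)))
    × (∀ (v : Carrier) → IsGeneratedBy M (singleton M v) (downset (Q.top ∗ v)))
    × (∀ (I : Pred Carrier ℓ) →
    IsIdeal M I ⇔ ∃ (λ v → (Q.top ∗ v ≡ v) × (I ≐ downset v)))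
    × (∀ (I : Pred Carrier ℓ) → IsIdeal M I →
    ∃ (λ v → IsGeneratedBy M (singleton M v) I))
    × (∀ (v : Carrier) → IsIdeal M (downset v) →
    IsOpIdeal M (λ w → (v ≤ w) × (w ≤ top)))
proposition3p2 Q M =
    (λ I → ideal≐downset)
  , downset-top∗⋁-generated
  , principal
  , (λ I → mk⇔ ideal⇒fixed-downset fixed-downset⇒ideal)
  , (λ I isI → ⋁ I , generated-by-join isI)
  , (λ v isI → upset-isOpIdeal (downset-ideal⇒absorbing isI))
  where
  open LeftModule M using (⋁)
  open Ideals M
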